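{- Let $\pi$ be $\mathrm{gp}$ or $\mathrm{mp}$, and let $a\ge 2$ and $n\ge a$. Among all graphs $G$ of order $n$ with $\chi_{\pi_i}(G)=a$, the unique one with the largest possible number of edges is the $a$-partite Turán graph of order $n$ (the complete $a$-partite graph on $n$ vertices whose part sizes differ by at most one).
   Context: A set $S$ is in general position (resp. monophonic position) if no shortest path (resp. induced path) contains more than two vertices of $S$; it is an independent general (resp. monophonic) position set if it is additionally independent. $\chi_{\mathrm{gp}_i}(G)$ (resp. $\chi_{\mathrm{mp}_i}(G)$) is the minimum number of colours in a colouring of $V(G)$ whose colour classes are all independent general (resp. monophonic) position sets. -}

module Defs where

open import Data.Nat using (ℕ; zero; suc; s≤s; _+_; _≤_; _<_; _<ᵇ_; _≡ᵇ_; NonZero)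
open import Data.Nat.DivMod using (_%_)
open import Data.Bool using (Bool; true; false; _∧_; not)
open import Data.Fin using (Fin; toℕ)
open import Data.List using (List; []; _∷_; length; head; last; lookup; map; allFin; filterᵇ)
open import Data.Nat.ListAction using (sum)
open import Data.List.Relation.Unary.Linked using (Linked)
open import Data.List.Relation.Unary.Unique.Propositional using (Unique)
open import Data.Product using (Σ; _×_; ∃)
open import Function.Bundles using (_↔_; Inverse)
open import Relation.Binary.PropositionalEquality using (_≡_)

record Graph (n : ℕ) : Set where
  field
    adj    : Fin n → Fin n → Bool
    adjSym : ∀ u v → adj u v ≡ adj v u
    adjIrr : ∀ u → adj u u ≡ false
open Graph public

edgeCount : ∀ {n} → Graph n → ℕ
edgeCount {n} G =
  sum (map (λ u → length (filterᵇ (λ v → (toℕ u <ᵇ toℕ v) ∧ adj G u v) (allFin n))) (allFin n))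

IsPath : ∀ {n} → Graph n → List (Fin n) → Set
IsPath G P = Linked (λ x y → adj G x y ≡ true) P × Unique P

IsShortestPath : ∀ {n} → Graph n → List (Fin n) → Set
IsShortestPath G P =
  IsPath G P ×
  (∀ Q → IsPath G Q → head Q ≡ head P → last Q ≡ last P → length P ≤ length Q)

IsInducedPath : ∀ {n} → Graph n → List (Fin n) → Set
IsInducedPath G P =
  IsPath G P ×
  (∀ (i j : Fin (length P)) → suc (toℕ i) < toℕ j → adj G (lookup P i) (lookup P j) ≡ false)

data PosType : Set where
  gp mp : PosType

PathOf : PosType → ∀ {n} → Graph n → List (Fin n) → Set
PathOf gp G P = IsShortestPath G P
PathOf mp G P = IsInducedPath G P

InPosition : PosType → ∀ {n} → Graph n → (Fin n → Bool) → Set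
InPosition π G S = ∀ P → PathOf π G P → length (filterᵇ S P) ≤ 2

Independent : ∀ {n} → Graph n → (Fin n → Bool) → Set
Independent G S = ∀ u v → S u ≡ true → S v ≡ true → adj G u v ≡ false

colourClass : ∀ {n k} → (Fin n → Fin k) → Fin k → Fin n → Bool
colourClass c j v = toℕ (c v) ≡ᵇ toℕ j

IsPiColouring : PosType → ∀ {n} → Graph n → (k : ℕ) → (Fin n → Fin k) → Set
IsPiColouring π G k c =
  ∀ j → Independent G (colourClass c j) × InPosition π G (colourClass c j)

ChiPiI≡ : PosType → ∀ {n} → Graph n → ℕ → Set
ChiPiI≡ π G a =
  (Σ (Fin _ → Fin a) λ c → IsPiColouring π G a c) ×
  (∀ k (c : Fin _ → Fin k) → IsPiColouring π G k c → a ≤ k)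

_≅_ : ∀ {n} → Graph n → Graph n → Set
_≅_ {n} G H = Σ (Fin n ↔ Fin n) λ f →
  ∀ u v → adj G u v ≡ adj H (Inverse.to f u) (Inverse.to f v)

-- the a-partite Turán graph of order n: vertex v lies in part (v mod a);
-- parts sizes differ by at most one
turán : (n a : ℕ) → .{{NonZero a}} → Graph n
turán n a = record
  { adj    = λ u v → not ((toℕ u % a) ≡ᵇ (toℕ v % a))
  ; adjSym = sym′
  ; adjIrr = irr
  }
  where
  open import Relation.Binary.PropositionalEquality using (refl; cong)
  open import Data.Nat.Properties using (≡ᵇ⇒≡; ≡⇒≡ᵇ)
  eqᵇ-sym : ∀ x y → (x ≡ᵇ y) ≡ (y ≡ᵇ x)
  eqᵇ-sym zero zero = refl
  eqᵇ-sym zero (suc y) = refl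
  eqᵇ-sym (suc x) zero = refl
  eqᵇ-sym (suc x) (suc y) = eqᵇ-sym x y
  eqᵇ-refl : ∀ x → (x ≡ᵇ x) ≡ true
  eqᵇ-refl zero = refl
  eqᵇ-refl (suc x) = eqᵇ-refl x
  sym′ : ∀ u v → _
  sym′ u v = cong not (eqᵇ-sym (toℕ u % a) (toℕ v % a))
  irr : ∀ u → _
  irr u = cong not (eqᵇ-refl (toℕ u % a))

2≤⇒nonZero : ∀ {a} → 2 ≤ a → NonZero a
2≤⇒nonZero (s≤s _) = _

-- A proper a-colouring c makes G a subgraph of the complete multipartite graph K_c whose parts are the
-- colour classes; counting ordered pairs, 2 e(K_c) = n² − Σⱼ sⱼ² for class sizes sⱼ.  Since
-- (s − q)(s − q − 1) ≥ 0 for integers, sⱼ² ≥ (2q + 1) sⱼ − q(q + 1), so with q = ⌊n/a⌋ the sum Σⱼ sⱼ² is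
-- minimal exactly when every sⱼ ∈ {q, q + 1}, as for the Turán graph.  Hence e(G) ≤ e(T), and equality
-- forces G = K_c with balanced classes, which is matched with T by sending the k-th vertex of each class
-- to the k-th vertex of a residue class of the same size.  Finally χ_π(T) = a: residue classes are
-- independent and meet every shortest or induced path of T, which has at most three vertices, at most
-- twice, while vertices 0, …, a − 1 form a clique.
module Submission where

open import Defs
open import Data.Bool using (Bool; true; false; not; _∧_; if_then_else_)
open import Data.Bool.Properties using (T-≡; T?)
open import Data.Empty using (⊥-elim)
open import Data.Fin as Fin using (Fin; toℕ; fromℕ<; inject≤)
open import Data.Fin.Patterns using (0F; 2F; 3F)
open import Data.Fin.Properties
  using (toℕ-injective; toℕ-fromℕ<; toℕ<n; toℕ-inject≤; injective⇒≤; punchOut-injective; any?)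
  renaming (_≟_ to _≟ᶠ_)
open import Data.List using (List; []; _∷_; length; map; filterᵇ; tabulate; last)
open import Data.List.Properties using (map-tabulate; length-filter)
open import Data.List.Relation.Unary.All using (All; []; _∷_)
open import Data.List.Relation.Unary.AllPairs using ([]; _∷_)
open import Data.List.Relation.Unary.Linked using (Linked; []; [-]; _∷_)
open import Data.Maybe using (just)
import Data.Nat.ListAction as ListAction
open import Data.Nat
open import Data.Nat.Properties
open import Data.Nat.DivMod
open import Data.Nat.Tactic.RingSolver using (solve-∀)
open import Data.Product using (∃; ∃-syntax; _×_; _,_; proj₁; proj₂)
open import Data.Sum using (_⊎_; inj₁; inj₂)
open import Function using (_∘_)
open import Function.Bundles using (Equivalence; _⇔_; mk⇔; _↔_; mk↔ₛ′)
open import Function.Definitions using (Injective)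
open import Relation.Binary.Definitions using (tri<; tri≈; tri>)
open import Relation.Binary.PropositionalEquality
open import Relation.Nullary using (¬_; yes; no; contradiction)
open import Relation.Nullary.Decidable as Dec using (dec-true; dec-false; does-≡)
open import Algebra.Properties.Semiring.Sum +-*-semiring
  using (sum-syntax; sum-cong-≗; sum-replicate-zero; ∑-distrib-+; ∑-comm; *-distribˡ-sum; *-distribʳ-sum)

private
  variable
    k m n a : ℕ

≡⇒≡ᵇ≡true : m ≡ n → (m ≡ᵇ n) ≡ true
≡⇒≡ᵇ≡true {m} {n} = dec-true (m ≟ n)

≢⇒≡ᵇ≡false : m ≢ n → (m ≡ᵇ n) ≡ false
≢⇒≡ᵇ≡false {m} {n} = dec-false (m ≟ n)

≡ᵇ≡true⇒≡ : (m ≡ᵇ n) ≡ true → m ≡ n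
≡ᵇ≡true⇒≡ {m} {n} e = ≡ᵇ⇒≡ m n (Equivalence.from T-≡ e)

≡ᵇ-sym : ∀ m n → (m ≡ᵇ n) ≡ (n ≡ᵇ m)
≡ᵇ-sym m n with m ≟ n
... | yes refl = refl
... | no m≢n   = trans (≢⇒≡ᵇ≡false m≢n) (sym (≢⇒≡ᵇ≡false (m≢n ∘ sym)))

<⇒<ᵇ≡true : m < n → (m <ᵇ n) ≡ true
<⇒<ᵇ≡true {m} {n} = dec-true (m <? n)

≮⇒<ᵇ≡false : ¬ m < n → (m <ᵇ n) ≡ false
≮⇒<ᵇ≡false {m} {n} = dec-false (m <? n)

⟦_⟧ : Bool → ℕ
⟦ true ⟧  = 1
⟦ false ⟧ = 0

⟦not⟧+⟦⟧ : ∀ b → ⟦ not b ⟧ + ⟦ b ⟧ ≡ 1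
⟦not⟧+⟦⟧ true  = refl
⟦not⟧+⟦⟧ false = refl

⟦⟧-mono : ∀ {b c} → (b ≡ true → c ≡ true) → ⟦ b ⟧ ≤ ⟦ c ⟧
⟦⟧-mono {false} _ = z≤n
⟦⟧-mono {true}  b⇒c rewrite b⇒c refl = ≤-refl

⟦⟧-injective : ∀ {b c} → ⟦ b ⟧ ≡ ⟦ c ⟧ → b ≡ c
⟦⟧-injective {true}  {true}  _ = refl
⟦⟧-injective {false} {false} _ = refl

∑-const : ∀ n c → ∑[ i < n ] c ≡ n * c
∑-const zero    c = refl
∑-const (suc n) c = cong (c +_) (∑-const n c)

∑-mono-≤ : {f g : Fin n → ℕ} → (∀ i → f i ≤ g i) → ∑[ i < n ] f i ≤ ∑[ i < n ] g i
∑-mono-≤ {zero}  f≤g = z≤n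
∑-mono-≤ {suc n} f≤g = +-mono-≤ (f≤g Fin.zero) (∑-mono-≤ (f≤g ∘ Fin.suc))

∑-mono-< : {f g : Fin n → ℕ} → (∀ i → f i ≤ g i) → ∀ k → f k < g k →
           ∑[ i < n ] f i < ∑[ i < n ] g i
∑-mono-< f≤g Fin.zero    fk<gk = +-mono-<-≤ fk<gk (∑-mono-≤ (f≤g ∘ Fin.suc))
∑-mono-< f≤g (Fin.suc k) fk<gk = +-mono-≤-< (f≤g Fin.zero) (∑-mono-< (f≤g ∘ Fin.suc) k fk<gk)

∑-mono-≤-≡⇒≡ : {f g : Fin n → ℕ} → (∀ i → f i ≤ g i) → ∑[ i < n ] f i ≡ ∑[ i < n ] g i →
               ∀ i → f i ≡ g i
∑-mono-≤-≡⇒≡ {f = f} {g} f≤g ∑f≡∑g i with f i ≟ g i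
... | yes fi≡gi = fi≡gi
... | no  fi≢gi = ⊥-elim (<-irrefl ∑f≡∑g (∑-mono-< f≤g i (≤∧≢⇒< (f≤g i) fi≢gi)))

∑-δ : (x : Fin n) (g : Fin n → ℕ) → ∑[ j < n ] (⟦ toℕ x ≡ᵇ toℕ j ⟧ * g j) ≡ g x
∑-δ {suc n} Fin.zero    g =
  trans (cong (g Fin.zero + 0 +_) (sum-replicate-zero n)) (trans (+-identityʳ _) (+-identityʳ _))
∑-δ {suc n} (Fin.suc x) g = ∑-δ x (g ∘ Fin.suc)

∑-tabulate : (f : Fin n → ℕ) → ListAction.sum (tabulate f) ≡ ∑[ i < n ] f i
∑-tabulate {zero}  f = refl
∑-tabulate {suc n} f = cong (f Fin.zero +_) (∑-tabulate (f ∘ Fin.suc))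

length-filterᵇ-tabulate : {A : Set} (p : A → Bool) (f : Fin n → A) →
                          length (filterᵇ p (tabulate f)) ≡ ∑[ i < n ] ⟦ p (f i) ⟧
length-filterᵇ-tabulate {zero}  p f = refl
length-filterᵇ-tabulate {suc n} p f with p (f Fin.zero)
... | true  = cong suc (length-filterᵇ-tabulate p (f ∘ Fin.suc))
... | false = length-filterᵇ-tabulate p (f ∘ Fin.suc)

pairCount : (Fin n → Fin n → Bool) → ℕ
pairCount {n} d = ∑[ u < n ] ∑[ v < n ] ⟦ d u v ⟧

pairCount-mono : {d e : Fin n → Fin n → Bool} → (∀ u v → d u v ≡ true → e u v ≡ true) →
                 pairCount d ≤ pairCount e
pairCount-mono d⊆e = ∑-mono-≤ (λ u → ∑-mono-≤ (λ v → ⟦⟧-mono (d⊆e u v)))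

pairCount-mono-≡⇒≡ : {d e : Fin n → Fin n → Bool} → (∀ u v → d u v ≡ true → e u v ≡ true) →
                     pairCount d ≡ pairCount e → ∀ u v → d u v ≡ e u v
pairCount-mono-≡⇒≡ {n} {d} {e} d⊆e pd≡pe u v =
  ⟦⟧-injective (∑-mono-≤-≡⇒≡ (λ v → ⟦⟧-mono (d⊆e u v)) rowᵤ v)
  where
  rowᵤ : ∑[ v < n ] ⟦ d u v ⟧ ≡ ∑[ v < n ] ⟦ e u v ⟧
  rowᵤ = ∑-mono-≤-≡⇒≡ (λ u → ∑-mono-≤ (λ v → ⟦⟧-mono (d⊆e u v))) pd≡pe u

upperAdj : Graph n → Fin n → Fin n → Bool
upperAdj G u v = (toℕ u <ᵇ toℕ v) ∧ adj G u v

edgeCount≡∑upperAdj : (G : Graph n) → edgeCount G ≡ ∑[ u < n ] ∑[ v < n ] ⟦ upperAdj G u v ⟧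
edgeCount≡∑upperAdj {n} G = begin
  ListAction.sum (map rowCount (tabulate (λ u → u))) ≡⟨ cong ListAction.sum (map-tabulate (λ u → u) rowCount) ⟩
  ListAction.sum (tabulate rowCount)                 ≡⟨ ∑-tabulate rowCount ⟩
  ∑[ u < n ] rowCount u
    ≡⟨ sum-cong-≗ (λ u → length-filterᵇ-tabulate (upperAdj G u) (λ v → v)) ⟩
  ∑[ u < n ] ∑[ v < n ] ⟦ upperAdj G u v ⟧           ∎
  where
  open ≡-Reasoning
  rowCount : Fin n → ℕ
  rowCount u = length (filterᵇ (upperAdj G u) (tabulate (λ v → v)))

⟦adj⟧≡⟦upperAdj⟧+⟦upperAdj⟧ : (G : Graph n) → ∀ u v →
                              ⟦ adj G u v ⟧ ≡ ⟦ upperAdj G u v ⟧ + ⟦ upperAdj G v u ⟧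
⟦adj⟧≡⟦upperAdj⟧+⟦upperAdj⟧ G u v with <-cmp (toℕ u) (toℕ v)
... | tri< u<v _ v≮u rewrite <⇒<ᵇ≡true u<v | ≮⇒<ᵇ≡false v≮u = sym (+-identityʳ _)
... | tri> u≮v _ v<u rewrite ≮⇒<ᵇ≡false u≮v | <⇒<ᵇ≡true v<u = cong ⟦_⟧ (adjSym G u v)
... | tri≈ u≮v u≡v v≮u rewrite ≮⇒<ᵇ≡false u≮v | ≮⇒<ᵇ≡false v≮u | toℕ-injective u≡v =
  cong ⟦_⟧ (adjIrr G v)

pairCount-adj : (G : Graph n) → pairCount (adj G) ≡ 2 * edgeCount G
pairCount-adj {n} G = begin
  pairCount (adj G)
    ≡⟨ sum-cong-≗ (λ u → trans (sum-cong-≗ (⟦adj⟧≡⟦upperAdj⟧+⟦upperAdj⟧ G u))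
                               (∑-distrib-+ (up u) (down u))) ⟩
  ∑[ u < n ] (∑[ v < n ] ⟦ upperAdj G u v ⟧ + ∑[ v < n ] ⟦ upperAdj G v u ⟧)
    ≡⟨ ∑-distrib-+ (λ u → ∑[ v < n ] up u v) (λ u → ∑[ v < n ] down u v) ⟩
  E + ∑[ u < n ] ∑[ v < n ] ⟦ upperAdj G v u ⟧
    ≡⟨ cong (E +_) (∑-comm (λ u v → ⟦ upperAdj G v u ⟧)) ⟩
  E + E
    ≡⟨ cong (E +_) (sym (+-identityʳ E)) ⟩
  2 * E
    ≡⟨ cong (2 *_) (sym (edgeCount≡∑upperAdj G)) ⟩
  2 * edgeCount G ∎
  where
  open ≡-Reasoning
  up down : Fin n → Fin n → ℕ
  up   u v = ⟦ upperAdj G u v ⟧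
  down u v = ⟦ upperAdj G v u ⟧
  E : ℕ
  E = ∑[ u < n ] ∑[ v < n ] ⟦ upperAdj G u v ⟧

count : (Fin m → Bool) → ℕ
count {m} P = ∑[ i < m ] ⟦ P i ⟧

partSize : (Fin n → Fin a) → Fin a → ℕ
partSize c j = count (colourClass c j)

sumOfSquares : (Fin n → Fin a) → ℕ
sumOfSquares {a = a} c = ∑[ j < a ] (partSize c j * partSize c j)

completeMultipartite : (Fin n → Fin a) → Fin n → Fin n → Bool
completeMultipartite c u v = not (colourClass c (c v) u)

IsProperColouring : Graph n → (Fin n → Fin a) → Set
IsProperColouring {a = a} G c = ∀ (j : Fin a) → Independent G (colourClass c j)

colourClass-self : (c : Fin n → Fin a) (v : Fin n) → colourClass c (c v) v ≡ true
colourClass-self c v = ≡⇒≡ᵇ≡true {toℕ (c v)} refl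

∑-partSize : (c : Fin n → Fin a) → ∑[ j < a ] partSize c j ≡ n
∑-partSize {n} {a} c = begin
  ∑[ j < a ] ∑[ v < n ] ⟦ colourClass c j v ⟧
    ≡⟨ ∑-comm (λ j v → ⟦ colourClass c j v ⟧) ⟩
  ∑[ v < n ] ∑[ j < a ] ⟦ colourClass c j v ⟧
    ≡⟨ sum-cong-≗ (λ v → trans (sum-cong-≗ {a} (λ j → sym (*-identityʳ ⟦ colourClass c j v ⟧)))
                               (∑-δ (c v) (λ _ → 1))) ⟩
  ∑[ v < n ] 1
    ≡⟨ trans (∑-const n 1) (*-identityʳ n) ⟩
  n ∎
  where open ≡-Reasoning

∑-sameColour : (c : Fin n → Fin a) → ∑[ u < n ] ∑[ v < n ] ⟦ colourClass c (c v) u ⟧ ≡ sumOfSquares c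
∑-sameColour {n} {a} c = begin
  ∑[ u < n ] ∑[ v < n ] ⟦ colourClass c (c v) u ⟧
    ≡⟨ ∑-comm (λ u v → ⟦ colourClass c (c v) u ⟧) ⟩
  ∑[ v < n ] partSize c (c v)
    ≡⟨ sum-cong-≗ (λ v → sym (∑-δ (c v) (partSize c))) ⟩
  ∑[ v < n ] ∑[ j < a ] (⟦ colourClass c j v ⟧ * partSize c j)
    ≡⟨ ∑-comm (λ v j → ⟦ colourClass c j v ⟧ * partSize c j) ⟩
  ∑[ j < a ] ∑[ v < n ] (⟦ colourClass c j v ⟧ * partSize c j)
    ≡⟨ sum-cong-≗ (λ j → sym (*-distribʳ-sum (partSize c j) (λ v → ⟦ colourClass c j v ⟧))) ⟩
  sumOfSquares c ∎
  where open ≡-Reasoning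

pairCount-completeMultipartite : (c : Fin n → Fin a) → pairCount (completeMultipartite c) + sumOfSquares c ≡ n * n
pairCount-completeMultipartite {n} c = begin
  pairCount (completeMultipartite c) + sumOfSquares c
    ≡⟨ cong (pairCount (completeMultipartite c) +_) (sym (∑-sameColour c)) ⟩
  ∑[ u < n ] ∑[ v < n ] ⟦ not (same u v) ⟧ + ∑[ u < n ] ∑[ v < n ] ⟦ same u v ⟧
    ≡⟨ sym (∑-distrib-+ (λ u → ∑[ v < n ] ⟦ not (same u v) ⟧) (λ u → ∑[ v < n ] ⟦ same u v ⟧)) ⟩
  ∑[ u < n ] (∑[ v < n ] ⟦ not (same u v) ⟧ + ∑[ v < n ] ⟦ same u v ⟧)
    ≡⟨ sum-cong-≗ (λ u → trans (sym (∑-distrib-+ (λ v → ⟦ not (same u v) ⟧) (λ v → ⟦ same u v ⟧)))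
                               (trans (sum-cong-≗ (λ v → ⟦not⟧+⟦⟧ (same u v))) (∑-const n 1))) ⟩
  ∑[ u < n ] (n * 1)
    ≡⟨ trans (∑-const n (n * 1)) (cong (n *_) (*-identityʳ n)) ⟩
  n * n ∎
  where
  open ≡-Reasoning
  same : Fin n → Fin n → Bool
  same u v = colourClass c (c v) u

proper⇒⊆completeMultipartite : (G : Graph n) (c : Fin n → Fin a) → IsProperColouring G c →
                               ∀ u v → adj G u v ≡ true → completeMultipartite c u v ≡ true
proper⇒⊆completeMultipartite G c proper u v uv with colourClass c (c v) u in same
... | false = refl
... | true  = contradiction (trans (sym uv) (proper (c v) u v same (colourClass-self c v))) λ ()

Balanced : ℕ → (Fin n → Fin a) → Set
Balanced {a = a} q c = ∀ (j : Fin a) → partSize c j ≡ q ⊎ partSize c j ≡ suc q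

-- s² − (2q + 1)s + q(q + 1) = (s − q)(s − q − 1) is a product of two consecutive integers.
square-excess : ∀ q s → ∃[ d ] (s * s + q * (q + 1) ≡ (2 * q + 1) * s + d * suc d) ×
                               (d ≡ 0 → s ≡ q ⊎ s ≡ suc q)
square-excess q s with s ≤? q
... | yes s≤q with d , refl ← m≤n⇒∃[o]m+o≡n s≤q =
  d , below s d , λ { refl → inj₁ (sym (+-identityʳ s)) }
  where
  below : ∀ s d → s * s + (s + d) * (s + d + 1) ≡ (2 * (s + d) + 1) * s + d * suc d
  below = solve-∀
... | no s≰q with d , refl ← m≤n⇒∃[o]m+o≡n (≰⇒> s≰q) =
  d , above q d , λ { refl → inj₂ (+-identityʳ (suc q)) }
  where
  above : ∀ q d → (suc q + d) * (suc q + d) + q * (q + 1) ≡ (2 * q + 1) * (suc q + d) + d * suc d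
  above = solve-∀

square-bound : ∀ q s → (2 * q + 1) * s ≤ s * s + q * (q + 1)
square-bound q s with d , eq , _ ← square-excess q s = ≤-trans (m≤m+n _ (d * suc d)) (≤-reflexive (sym eq))

square-bound-≡⇒ : ∀ q s → (2 * q + 1) * s ≡ s * s + q * (q + 1) → s ≡ q ⊎ s ≡ suc q
square-bound-≡⇒ q s tight with d , eq , d≡0⇒ ← square-excess q s =
  d≡0⇒ (m*n≡0⇒m≡0 d (suc d) (+-cancelˡ-≡ ((2 * q + 1) * s) _ 0
    (trans (sym eq) (trans (sym tight) (sym (+-identityʳ _))))))

square-bound-⇒≡ : ∀ q s → s ≡ q ⊎ s ≡ suc q → (2 * q + 1) * s ≡ s * s + q * (q + 1)
square-bound-⇒≡ q s (inj₁ refl) = atLower s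
  where
  atLower : ∀ q → (2 * q + 1) * q ≡ q * q + q * (q + 1)
  atLower = solve-∀
square-bound-⇒≡ q s (inj₂ refl) = atUpper q
  where
  atUpper : ∀ q → (2 * q + 1) * suc q ≡ suc q * suc q + q * (q + 1)
  atUpper = solve-∀

module _ (q : ℕ) (c : Fin n → Fin a) where

  private
    ∑-linear : ∑[ j < a ] ((2 * q + 1) * partSize c j) ≡ (2 * q + 1) * n
    ∑-linear = trans (sym (*-distribˡ-sum (2 * q + 1) (partSize c))) (cong ((2 * q + 1) *_) (∑-partSize c))

    ∑-quadratic : ∑[ j < a ] (partSize c j * partSize c j + q * (q + 1)) ≡ sumOfSquares c + a * (q * (q + 1))
    ∑-quadratic = trans (∑-distrib-+ (λ j → partSize c j * partSize c j) (λ _ → q * (q + 1)))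
                        (cong (sumOfSquares c +_) (∑-const a (q * (q + 1))))

  sumOfSquares-bound : (2 * q + 1) * n ≤ sumOfSquares c + a * (q * (q + 1))
  sumOfSquares-bound = subst₂ _≤_ ∑-linear ∑-quadratic (∑-mono-≤ (square-bound q ∘ partSize c))

  balanced⇒sumOfSquares-bound-≡ : Balanced q c → (2 * q + 1) * n ≡ sumOfSquares c + a * (q * (q + 1))
  balanced⇒sumOfSquares-bound-≡ balanced =
    trans (sym ∑-linear) (trans (sum-cong-≗ (λ j → square-bound-⇒≡ q (partSize c j) (balanced j))) ∑-quadratic)

  sumOfSquares-bound-≡⇒balanced : (2 * q + 1) * n ≡ sumOfSquares c + a * (q * (q + 1)) → Balanced q c
  sumOfSquares-bound-≡⇒balanced tight j =
    square-bound-≡⇒ q (partSize c j)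
      (∑-mono-≤-≡⇒≡ (square-bound q ∘ partSize c) (trans ∑-linear (trans tight (sym ∑-quadratic))) j)

module _ {q : ℕ} {c c′ : Fin n → Fin a} (balanced′ : Balanced q c′) where

  private
    A : ℕ
    A = a * (q * (q + 1))

  balanced-sumOfSquares-≤ : sumOfSquares c′ ≤ sumOfSquares c
  balanced-sumOfSquares-≤ = +-cancelʳ-≤ A _ _
    (subst (_≤ sumOfSquares c + A) (balanced⇒sumOfSquares-bound-≡ q c′ balanced′) (sumOfSquares-bound q c))

  sumOfSquares-≡⇒balanced : sumOfSquares c ≡ sumOfSquares c′ → Balanced q c
  sumOfSquares-≡⇒balanced eq = sumOfSquares-bound-≡⇒balanced q c
    (trans (balanced⇒sumOfSquares-bound-≡ q c′ balanced′) (cong (_+ A) (sym eq)))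

  completeMultipartite-pairCount-≤ : pairCount (completeMultipartite c) ≤ pairCount (completeMultipartite c′)
  completeMultipartite-pairCount-≤ = +-cancelʳ-≤ (sumOfSquares c′) _ _ (begin
    pairCount (completeMultipartite c) + sumOfSquares c′ ≤⟨ +-monoʳ-≤ _ balanced-sumOfSquares-≤ ⟩
    pairCount (completeMultipartite c) + sumOfSquares c  ≡⟨ pairCount-completeMultipartite c ⟩
    n * n                                               ≡⟨ pairCount-completeMultipartite c′ ⟨
    pairCount (completeMultipartite c′) + sumOfSquares c′ ∎)
    where open ≤-Reasoning

  completeMultipartite-pairCount-≡⇒balanced :
    pairCount (completeMultipartite c) ≡ pairCount (completeMultipartite c′) → Balanced q c
  completeMultipartite-pairCount-≡⇒balanced eq =
    sumOfSquares-≡⇒balanced (+-cancelˡ-≡ (pairCount (completeMultipartite c)) _ _ (begin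
    pairCount (completeMultipartite c) + sumOfSquares c   ≡⟨ pairCount-completeMultipartite c ⟩
    n * n                                                ≡⟨ pairCount-completeMultipartite c′ ⟨
    pairCount (completeMultipartite c′) + sumOfSquares c′ ≡⟨ cong (_+ sumOfSquares c′) eq ⟨
    pairCount (completeMultipartite c) + sumOfSquares c′  ∎))
    where open ≡-Reasoning

turánColouring : .{{NonZero a}} → Fin n → Fin a
turánColouring {a} v = fromℕ< (m%n<n (toℕ v) a)

toℕ-turánColouring : .{{_ : NonZero a}} (v : Fin n) → toℕ (turánColouring {a = a} v) ≡ toℕ v % a
toℕ-turánColouring {a} v = toℕ-fromℕ< (m%n<n (toℕ v) a)

adj-turán : .{{_ : NonZero a}} (u v : Fin n) → adj (turán n a) u v ≡ completeMultipartite turánColouring u v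
adj-turán u v = cong₂ (λ x y → not (x ≡ᵇ y)) (sym (toℕ-turánColouring u)) (sym (toℕ-turánColouring v))

∑-split : ∀ m k (g : ℕ → ℕ) →
          ∑[ i < m + k ] g (toℕ i) ≡ ∑[ i < m ] g (toℕ i) + ∑[ i < k ] g (m + toℕ i)
∑-split zero    k g = refl
∑-split (suc m) k g = trans (cong (g 0 +_) (∑-split m k (g ∘ suc))) (sym (+-assoc (g 0) _ _))

∑-periodic : ∀ a q (g : ℕ → ℕ) → (∀ i → g (a + i) ≡ g i) →
             ∑[ i < q * a ] g (toℕ i) ≡ q * ∑[ i < a ] g (toℕ i)
∑-periodic a zero    g periodic = refl
∑-periodic a (suc q) g periodic = begin
  ∑[ i < a + q * a ] g (toℕ i)                          ≡⟨ ∑-split a (q * a) g ⟩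
  ∑[ i < a ] g (toℕ i) + ∑[ i < q * a ] g (a + toℕ i)  ≡⟨ cong (block +_) (sum-cong-≗ {q * a} (periodic ∘ toℕ)) ⟩
  block + ∑[ i < q * a ] g (toℕ i)                      ≡⟨ cong (block +_) (∑-periodic a q g periodic) ⟩
  block + q * block                                     ∎
  where
  open ≡-Reasoning
  block : ℕ
  block = ∑[ i < a ] g (toℕ i)

module _ .{{_ : NonZero a}} (j : Fin a) where

  private
    inResidueClass : ℕ → ℕ
    inResidueClass i = ⟦ i % a ≡ᵇ toℕ j ⟧

    ∑-residueClass : ∑[ i < a ] inResidueClass (toℕ i) ≡ 1
    ∑-residueClass = begin
      ∑[ i < a ] ⟦ toℕ i % a ≡ᵇ toℕ j ⟧
        ≡⟨ sum-cong-≗ {a} (λ i → cong (λ x → ⟦ x ≡ᵇ toℕ j ⟧) (m<n⇒m%n≡m (toℕ<n i))) ⟩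
      ∑[ i < a ] ⟦ toℕ i ≡ᵇ toℕ j ⟧
        ≡⟨ sum-cong-≗ {a} (λ i → trans (cong ⟦_⟧ (≡ᵇ-sym (toℕ i) (toℕ j))) (sym (*-identityʳ _))) ⟩
      ∑[ i < a ] (⟦ toℕ j ≡ᵇ toℕ i ⟧ * 1)
        ≡⟨ ∑-δ j (λ _ → 1) ⟩
      1 ∎
      where open ≡-Reasoning

  turánColouring-partSize : ∃[ x ] partSize (turánColouring {a = a} {n = n}) j ≡ n / a + x × x ≤ 1
  turánColouring-partSize {n} = x , partSize≡ , x≤1
    where
    q r x : ℕ
    q = n / a
    r = n % a
    x = ∑[ i < r ] inResidueClass (q * a + toℕ i)

    x≡ : x ≡ ∑[ i < r ] inResidueClass (toℕ i)
    x≡ = sum-cong-≗ {r} (λ i → cong (λ y → ⟦ y ≡ᵇ toℕ j ⟧)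
                                    (trans (cong (_% a) (+-comm (q * a) (toℕ i))) ([m+kn]%n≡m%n (toℕ i) q a)))

    x≤1 : x ≤ 1
    x≤1 with k , r+k≡a ← m≤n⇒∃[o]m+o≡n (<⇒≤ (m%n<n n a)) = begin
      x                                                  ≡⟨ x≡ ⟩
      ∑[ i < r ] inResidueClass (toℕ i)                  ≤⟨ m≤m+n _ _ ⟩
      ∑[ i < r ] inResidueClass (toℕ i) + ∑[ i < k ] inResidueClass (r + toℕ i)
                                                         ≡⟨ ∑-split r k inResidueClass ⟨
      ∑[ i < r + k ] inResidueClass (toℕ i)              ≡⟨ cong (λ m → ∑[ i < m ] inResidueClass (toℕ i)) r+k≡a ⟩
      ∑[ i < a ] inResidueClass (toℕ i)                  ≡⟨ ∑-residueClass ⟩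
      1                                                  ∎
      where open ≤-Reasoning

    partSize≡ : partSize (turánColouring {a = a} {n = n}) j ≡ q + x
    partSize≡ = begin
      ∑[ v < n ] ⟦ toℕ (turánColouring v) ≡ᵇ toℕ j ⟧
        ≡⟨ sum-cong-≗ {n} (λ v → cong (λ y → ⟦ y ≡ᵇ toℕ j ⟧) (toℕ-turánColouring v)) ⟩
      ∑[ v < n ] inResidueClass (toℕ v)
        ≡⟨ cong (λ m → ∑[ i < m ] inResidueClass (toℕ i)) (trans (m≡m%n+[m/n]*n n a) (+-comm r (q * a))) ⟩
      ∑[ i < q * a + r ] inResidueClass (toℕ i)        ≡⟨ ∑-split (q * a) r inResidueClass ⟩
      ∑[ i < q * a ] inResidueClass (toℕ i) + x        ≡⟨ cong (_+ x) (∑-periodic a q inResidueClass periodic) ⟩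
      q * ∑[ i < a ] inResidueClass (toℕ i) + x        ≡⟨ cong (λ y → q * y + x) ∑-residueClass ⟩
      q * 1 + x                                        ≡⟨ cong (_+ x) (*-identityʳ q) ⟩
      q + x                                            ∎
      where
      open ≡-Reasoning
      periodic : ∀ i → inResidueClass (a + i) ≡ inResidueClass i
      periodic i = cong (λ y → ⟦ y ≡ᵇ toℕ j ⟧) (trans (cong (_% a) (+-comm a i)) ([m+n]%n≡m%n i a))

turánColouring-balanced : .{{_ : NonZero a}} → Balanced (n / a) (turánColouring {a = a} {n = n})
turánColouring-balanced j with turánColouring-partSize j
... | 0 , size≡ , _ = inj₁ (trans size≡ (+-identityʳ _))
... | 1 , size≡ , _ = inj₂ (trans size≡ (+-comm _ 1))
... | suc (suc _) , _ , s≤s ()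

rank : (Fin m → Bool) → Fin m → ℕ
rank {m} P x = ∑[ i < m ] ⟦ (toℕ i <ᵇ toℕ x) ∧ P i ⟧

module _ (P : Fin m → Bool) where

  private
    ⟦<ᵇ∧⟧-mono : ∀ {x y : Fin m} → toℕ x ≤ toℕ y →
                 ∀ i → ⟦ (toℕ i <ᵇ toℕ x) ∧ P i ⟧ ≤ ⟦ (toℕ i <ᵇ toℕ y) ∧ P i ⟧
    ⟦<ᵇ∧⟧-mono {x} {y} x≤y i with toℕ i <ᵇ toℕ x in i<ᵇx
    ... | false = z≤n
    ... | true rewrite <⇒<ᵇ≡true (<-≤-trans (<ᵇ⇒< (toℕ i) (toℕ x) (Equivalence.from T-≡ i<ᵇx)) x≤y) =
      ≤-refl

    ⟦<ᵇ∧⟧≤⟦⟧ : ∀ (x i : Fin m) → ⟦ (toℕ i <ᵇ toℕ x) ∧ P i ⟧ ≤ ⟦ P i ⟧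
    ⟦<ᵇ∧⟧≤⟦⟧ x i with toℕ i <ᵇ toℕ x
    ... | false = z≤n
    ... | true  = ≤-refl

    ⟦<ᵇself∧⟧≡0 : ∀ (x : Fin m) → ⟦ (toℕ x <ᵇ toℕ x) ∧ P x ⟧ ≡ 0
    ⟦<ᵇself∧⟧≡0 x rewrite ≮⇒<ᵇ≡false {toℕ x} (<-irrefl refl) = refl

  rank<count : ∀ {x : Fin m} → P x ≡ true → rank P x < count P
  rank<count {x} Px = ∑-mono-< (⟦<ᵇ∧⟧≤⟦⟧ x) x (subst₂ _<_ (sym (⟦<ᵇself∧⟧≡0 x)) (sym (cong ⟦_⟧ Px)) z<s)

  rank-mono-< : ∀ {x y : Fin m} → P x ≡ true → toℕ x < toℕ y → rank P x < rank P y
  rank-mono-< {x} {y} Px x<y = ∑-mono-< (⟦<ᵇ∧⟧-mono (<⇒≤ x<y)) x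
    (subst₂ _<_ (sym (⟦<ᵇself∧⟧≡0 x)) (sym (cong (λ b → ⟦ b ∧ P x ⟧) (<⇒<ᵇ≡true x<y)))
                (subst (λ b → 0 < ⟦ b ⟧) (sym Px) z<s))

  rank-injective : ∀ {x y : Fin m} → P x ≡ true → P y ≡ true → rank P x ≡ rank P y → x ≡ y
  rank-injective {x} {y} Px Py rx≡ry with <-cmp (toℕ x) (toℕ y)
  ... | tri< x<y _ _ = contradiction rx≡ry (<⇒≢ (rank-mono-< Px x<y))
  ... | tri≈ _ x≡y _ = toℕ-injective x≡y
  ... | tri> _ _ y<x = contradiction (sym rx≡ry) (<⇒≢ (rank-mono-< Py y<x))

  count-not+count : count (not ∘ P) + count P ≡ m
  count-not+count = begin
    count (not ∘ P) + count P          ≡⟨ ∑-distrib-+ (λ i → ⟦ not (P i) ⟧) (λ i → ⟦ P i ⟧) ⟨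
    ∑[ i < m ] (⟦ not (P i) ⟧ + ⟦ P i ⟧) ≡⟨ sum-cong-≗ {m} (⟦not⟧+⟦⟧ ∘ P) ⟩
    ∑[ i < m ] 1                        ≡⟨ trans (∑-const m 1) (*-identityʳ m) ⟩
    m                                  ∎
    where open ≡-Reasoning

partitionIndex : (Fin m → Bool) → Fin m → ℕ
partitionIndex P j = if P j then rank P j else count P + rank (not ∘ P) j

module _ (P : Fin m → Bool) where

  partitionIndex<count : ∀ {j} → P j ≡ true → partitionIndex P j < count P
  partitionIndex<count {j} Pj with P j in Pj′
  partitionIndex<count {j} _  | true = rank<count P Pj′

  partitionIndex<m : ∀ j → partitionIndex P j < m
  partitionIndex<m j with P j in Pj
  ... | true  = <-≤-trans (rank<count P Pj)
                          (subst (count P ≤_) (count-not+count P) (m≤n+m (count P) (count (not ∘ P))))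
  ... | false = subst (count P + rank (not ∘ P) j <_) (trans (+-comm (count P) (count (not ∘ P))) (count-not+count P))
                      (+-monoʳ-< (count P) (rank<count (not ∘ P) (cong not Pj)))

  partitionIndex-injective : ∀ {i j} → partitionIndex P i ≡ partitionIndex P j → i ≡ j
  partitionIndex-injective {i} {j} pi≡pj with P i in Pi | P j in Pj
  ... | true  | true  = rank-injective P Pi Pj pi≡pj
  ... | true  | false = contradiction pi≡pj (<⇒≢ (<-≤-trans (rank<count P Pi) (m≤m+n _ _)))
  ... | false | true  = contradiction (sym pi≡pj) (<⇒≢ (<-≤-trans (rank<count P Pj) (m≤m+n _ _)))
  ... | false | false = rank-injective (not ∘ P) (cong not Pi) (cong not Pj) (+-cancelˡ-≡ (count P) _ _ pi≡pj)

injective⇒surjective : (f : Fin n → Fin n) → Injective _≡_ _≡_ f → ∀ y → ∃ λ x → f x ≡ y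
injective⇒surjective f f-injective y with any? (λ x → f x ≟ᶠ y)
... | yes found = found
injective⇒surjective {suc n} f f-injective y | no notFound =
  contradiction (injective⇒≤ punchedOut-injective) 1+n≰n
  where
  f≢y : ∀ x → y ≢ f x
  f≢y x y≡fx = notFound (x , sym y≡fx)
  punchedOut-injective : Injective _≡_ _≡_ (λ x → Fin.punchOut (f≢y x))
  punchedOut-injective = f-injective ∘ punchOut-injective (f≢y _) (f≢y _)

injective⇒↔ : (f : Fin n → Fin n) → Injective _≡_ _≡_ f → Fin n ↔ Fin n
injective⇒↔ f f-injective =
  mk↔ₛ′ f (proj₁ ∘ surjective) (proj₂ ∘ surjective) (λ x → f-injective (proj₂ (surjective (f x))))
  where
  surjective : ∀ y → ∃ λ x → f x ≡ y
  surjective = injective⇒surjective f f-injective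

≡ᵇ-cong : ∀ {m n m′ n′} → m ≡ n ⇔ m′ ≡ n′ → (m ≡ᵇ n) ≡ (m′ ≡ᵇ n′)
≡ᵇ-cong {m} {n} {m′} {n′} equiv = does-≡ (Dec.map equiv (m ≟ n)) (m′ ≟ n′)

-- Listing the big classes
-- (of size ⌊n/a⌋ + 1) first sends them to the n mod a residues whose Turán parts have ⌊n/a⌋ + 1 vertices.
module Placement .{{_ : NonZero a}} (c : Fin n → Fin a) (balanced : Balanced (n / a) c) where

  private
    q r : ℕ
    q = n / a
    r = n % a

    big : Fin a → Bool
    big j = partSize c j ≡ᵇ suc q

    partSize≡q+⟦big⟧ : ∀ j → partSize c j ≡ q + ⟦ big j ⟧
    partSize≡q+⟦big⟧ j with balanced j
    ... | inj₁ size≡q   = trans size≡q (sym (trans (cong (λ b → q + ⟦ b ⟧) big≡false) (+-identityʳ q)))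
      where
      big≡false : big j ≡ false
      big≡false = trans (cong (_≡ᵇ suc q) size≡q) (≢⇒≡ᵇ≡false (<⇒≢ (n<1+n q)))
    ... | inj₂ size≡1+q = trans size≡1+q (sym (trans (cong (λ b → q + ⟦ b ⟧) big≡true) (+-comm q 1)))
      where
      big≡true : big j ≡ true
      big≡true = trans (cong (_≡ᵇ suc q) size≡1+q) (≡⇒≡ᵇ≡true {suc q} refl)

    n≡r+q*a : n ≡ r + q * a
    n≡r+q*a = m≡m%n+[m/n]*n n a

    count-big : count big ≡ r
    count-big = +-cancelˡ-≡ (q * a) _ _ (begin
      q * a + count big                        ≡⟨ cong (_+ count big) (trans (*-comm q a) (sym (∑-const a q))) ⟩
      ∑[ j < a ] q + ∑[ j < a ] ⟦ big j ⟧      ≡⟨ ∑-distrib-+ (λ _ → q) (⟦_⟧ ∘ big) ⟨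
      ∑[ j < a ] (q + ⟦ big j ⟧)              ≡⟨ sum-cong-≗ {a} (sym ∘ partSize≡q+⟦big⟧) ⟩
      ∑[ j < a ] partSize c j                 ≡⟨ ∑-partSize c ⟩
      n                                       ≡⟨ trans n≡r+q*a (+-comm r (q * a)) ⟩
      q * a + r                               ∎)
      where open ≡-Reasoning

    vertexRank : Fin n → ℕ
    vertexRank v = rank (colourClass c (c v)) v

    vertexRank<q+⟦big⟧ : ∀ v → vertexRank v < q + ⟦ big (c v) ⟧
    vertexRank<q+⟦big⟧ v =
      subst (vertexRank v <_) (partSize≡q+⟦big⟧ (c v)) (rank<count (colourClass c (c v)) (colourClass-self c v))

    place : Fin n → ℕ
    place v = partitionIndex big (c v) + vertexRank v * a

    place<n : ∀ v → place v < n
    place<n v = byClassSize (big (c v)) refl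
      where
      byClassSize : ∀ b → big (c v) ≡ b → place v < n
      byClassSize true bigᵥ = subst (place v <_) (sym n≡r+q*a)
        (+-mono-<-≤ (subst (partitionIndex big (c v) <_) count-big (partitionIndex<count big bigᵥ))
                    (*-monoˡ-≤ a rankᵥ≤q))
        where
        rankᵥ≤q : vertexRank v ≤ q
        rankᵥ≤q = s≤s⁻¹ (subst (vertexRank v <_) (trans (cong (λ b → q + ⟦ b ⟧) bigᵥ) (+-comm q 1))
                                (vertexRank<q+⟦big⟧ v))
      byClassSize false bigᵥ = begin-strict
        partitionIndex big (c v) + vertexRank v * a  <⟨ +-monoˡ-< (vertexRank v * a) (partitionIndex<m big (c v)) ⟩
        suc (vertexRank v) * a                       ≤⟨ *-monoˡ-≤ a rankᵥ<q ⟩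
        q * a                                        ≤⟨ m≤n+m (q * a) r ⟩
        r + q * a                                    ≡⟨ n≡r+q*a ⟨
        n                                            ∎
        where
        open ≤-Reasoning
        rankᵥ<q : vertexRank v < q
        rankᵥ<q = subst (vertexRank v <_) (trans (cong (λ b → q + ⟦ b ⟧) bigᵥ) (+-identityʳ q)) (vertexRank<q+⟦big⟧ v)

    place%a : ∀ v → place v % a ≡ partitionIndex big (c v)
    place%a v = trans ([m+kn]%n≡m%n _ (vertexRank v) a) (m<n⇒m%n≡m (partitionIndex<m big (c v)))

    place-injective : ∀ {u v} → place u ≡ place v → u ≡ v
    place-injective {u} {v} pu≡pv = rank-injective (colourClass c (c v)) sameClass (colourClass-self c v) sameRank
      where
      sameIndex : partitionIndex big (c u) ≡ partitionIndex big (c v)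
      sameIndex = trans (sym (place%a u)) (trans (cong (_% a) pu≡pv) (place%a v))
      sameColour : c u ≡ c v
      sameColour = partitionIndex-injective big sameIndex
      sameClass : colourClass c (c v) u ≡ true
      sameClass = ≡⇒≡ᵇ≡true (cong toℕ sameColour)
      sameRank : rank (colourClass c (c v)) u ≡ rank (colourClass c (c v)) v
      sameRank = trans (cong (λ j → rank (colourClass c j) u) (sym sameColour))
        (*-cancelʳ-≡ _ _ a (+-cancelˡ-≡ (partitionIndex big (c v)) _ _
          (trans (cong (_+ vertexRank u * a) (sym sameIndex)) pu≡pv)))

    placement : Fin n → Fin n
    placement v = fromℕ< (place<n v)

    placement-injective : Injective _≡_ _≡_ placement
    placement-injective {u} {v} e =
      place-injective (trans (sym (toℕ-fromℕ< (place<n u))) (trans (cong toℕ e) (toℕ-fromℕ< (place<n v))))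

    adj-turán-placement : ∀ u v → adj (turán n a) (placement u) (placement v) ≡ completeMultipartite c u v
    adj-turán-placement u v = cong not (trans (cong₂ _≡ᵇ_ (residue u) (residue v)) (≡ᵇ-cong sameIndex⇔sameColour))
      where
      residue : ∀ w → toℕ (placement w) % a ≡ partitionIndex big (c w)
      residue w = trans (cong (_% a) (toℕ-fromℕ< (place<n w))) (place%a w)
      sameIndex⇔sameColour : partitionIndex big (c u) ≡ partitionIndex big (c v) ⇔ toℕ (c u) ≡ toℕ (c v)
      sameIndex⇔sameColour = mk⇔ (cong toℕ ∘ partitionIndex-injective big) (cong (partitionIndex big) ∘ toℕ-injective)

  completeMultipartite≅turán : (G : Graph n) → (∀ u v → adj G u v ≡ completeMultipartite c u v) → G ≅ turán n a
  completeMultipartite≅turán G adj≡ = injective⇒↔ placement placement-injective ,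
    λ u v → trans (adj≡ u v) (sym (adj-turán-placement u v))

module _ .{{_ : NonZero a}} (G : Graph n) (c : Fin n → Fin a) (proper : IsProperColouring G c) where

  private
    T : Graph n
    T = turán n a

    cᵀ : Fin n → Fin a
    cᵀ = turánColouring

    K Kᵀ : Fin n → Fin n → Bool
    K  = completeMultipartite c
    Kᵀ = completeMultipartite cᵀ

    pairCount-turán : pairCount (adj T) ≡ pairCount Kᵀ
    pairCount-turán = sum-cong-≗ {n} (λ u → sum-cong-≗ {n} (λ v → cong ⟦_⟧ (adj-turán u v)))

    pairCount-G≤K : pairCount (adj G) ≤ pairCount K
    pairCount-G≤K = pairCount-mono (proper⇒⊆completeMultipartite G c proper)

    pairCount-K≤Kᵀ : pairCount K ≤ pairCount Kᵀ
    pairCount-K≤Kᵀ = completeMultipartite-pairCount-≤ {c = c} {c′ = cᵀ} (turánColouring-balanced {n = n})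

  edgeCount-≤-turán : edgeCount G ≤ edgeCount T
  edgeCount-≤-turán = *-cancelˡ-≤ 2 (begin
    2 * edgeCount G    ≡⟨ pairCount-adj G ⟨
    pairCount (adj G)  ≤⟨ pairCount-G≤K ⟩
    pairCount K        ≤⟨ pairCount-K≤Kᵀ ⟩
    pairCount Kᵀ       ≡⟨ pairCount-turán ⟨
    pairCount (adj T)  ≡⟨ pairCount-adj T ⟩
    2 * edgeCount T    ∎)
    where open ≤-Reasoning

  edgeCount-≡-turán⇒≅ : edgeCount G ≡ edgeCount T → G ≅ T
  edgeCount-≡-turán⇒≅ eG≡eT = Placement.completeMultipartite≅turán c balanced G adj≡K
    where
    pG≡pKᵀ : pairCount (adj G) ≡ pairCount Kᵀ
    pG≡pKᵀ = trans (pairCount-adj G) (trans (cong (2 *_) eG≡eT) (trans (sym (pairCount-adj T)) pairCount-turán))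
    pG≡pK : pairCount (adj G) ≡ pairCount K
    pG≡pK = ≤-antisym pairCount-G≤K (subst (pairCount K ≤_) (sym pG≡pKᵀ) pairCount-K≤Kᵀ)
    adj≡K : ∀ u v → adj G u v ≡ completeMultipartite c u v
    adj≡K = pairCount-mono-≡⇒≡ (proper⇒⊆completeMultipartite G c proper) pG≡pK
    balanced : Balanced (n / a) c
    balanced = completeMultipartite-pairCount-≡⇒balanced {c = c} {c′ = cᵀ} (turánColouring-balanced {n = n})
                                                         (trans (sym pG≡pK) pG≡pKᵀ)

independent-meets-short-walk : (G : Graph n) (S : Fin n → Bool) → Independent G S → ∀ P →
                               Linked (λ x y → adj G x y ≡ true) P → length P ≤ 3 → length (filterᵇ S P) ≤ 2
independent-meets-short-walk G S independent [] _ _ = z≤n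
independent-meets-short-walk G S independent (x ∷ []) _ _ = ≤-trans (length-filter (T? ∘ S) (x ∷ [])) (s≤s z≤n)
independent-meets-short-walk G S independent (x ∷ y ∷ []) _ _ = length-filter (T? ∘ S) (x ∷ y ∷ [])
independent-meets-short-walk G S independent (x ∷ y ∷ z ∷ []) (xy ∷ _) _ with S x in Sx | S y in Sy
... | true  | true  = contradiction (trans (sym xy) (independent x y Sx Sy)) λ ()
... | true  | false rewrite Sy = s≤s (length-filter (T? ∘ S) (z ∷ []))
... | false | _     = length-filter (T? ∘ S) (y ∷ z ∷ [])
independent-meets-short-walk G S independent (_ ∷ _ ∷ _ ∷ _ ∷ _) _ (s≤s (s≤s (s≤s ())))

clique⇒≤colours : (G : Graph n) (f : Fin m → Fin n) → (∀ i j → i ≢ j → adj G (f i) (f j) ≡ true) →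
                  (c : Fin n → Fin k) → IsProperColouring G c → m ≤ k
clique⇒≤colours G f clique c proper = injective⇒≤ {f = c ∘ f} injective
  where
  injective : Injective _≡_ _≡_ (c ∘ f)
  injective {i} {j} cfi≡cfj with i ≟ᶠ j
  ... | yes i≡j = i≡j
  ... | no  i≢j =
    contradiction (trans (sym (clique i j i≢j)) (proper (c (f j)) (f i) (f j) sameClass (colourClass-self c (f j)))) λ ()
    where
    sameClass : colourClass c (c (f j)) (f i) ≡ true
    sameClass = ≡⇒≡ᵇ≡true (cong toℕ cfi≡cfj)

All-last : {A : Set} {P : A → Set} (y : A) (ys : List A) → All P (y ∷ ys) →
           ∃ λ z → last (y ∷ ys) ≡ just z × P z
All-last y []        (Py ∷ [])  = y , refl , Py
All-last y (y′ ∷ ys) (_  ∷ Pys) = All-last y′ ys Pys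

module CompleteMultipartiteBy (G : Graph n) (ρ : Fin n → ℕ) (adj≡ : ∀ u v → adj G u v ≡ not (ρ u ≡ᵇ ρ v))
  where

  adj-true : ∀ {u v} → ρ u ≢ ρ v → adj G u v ≡ true
  adj-true {u} {v} ρu≢ρv = trans (adj≡ u v) (cong not (≢⇒≡ᵇ≡false ρu≢ρv))

  adj-true⇒ : ∀ {u v} → adj G u v ≡ true → ρ u ≢ ρ v
  adj-true⇒ {u} {v} uv ρu≡ρv =
    contradiction (trans (sym uv) (trans (adj≡ u v) (cong not (≡⇒≡ᵇ≡true ρu≡ρv)))) λ ()

  adj-false⇒ : ∀ {u v} → adj G u v ≡ false → ρ u ≡ ρ v
  adj-false⇒ {u} {v} ¬uv with ρ u ≟ ρ v
  ... | yes ρu≡ρv = ρu≡ρv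
  ... | no  ρu≢ρv = contradiction (trans (sym (adj-true ρu≢ρv)) ¬uv) λ ()

  -- Vertices 0 and 2 and vertices 0 and 3 of an induced path lie in common parts, so 2 and 3 cannot be adjacent.
  inducedPath-length≤3 : ∀ P → IsInducedPath G P → length P ≤ 3
  inducedPath-length≤3 []                  _ = z≤n
  inducedPath-length≤3 (_ ∷ [])            _ = s≤s z≤n
  inducedPath-length≤3 (_ ∷ _ ∷ [])        _ = s≤s (s≤s z≤n)
  inducedPath-length≤3 (_ ∷ _ ∷ _ ∷ [])    _ = ≤-refl
  inducedPath-length≤3 (x₀ ∷ x₁ ∷ x₂ ∷ x₃ ∷ _) (((_ ∷ _ ∷ x₂x₃ ∷ _) , _) , induced) =
    contradiction (trans (sym (adj-false⇒ (induced 0F 2F (s≤s (s≤s z≤n)))))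
                         (adj-false⇒ (induced 0F 3F (s≤s (s≤s z≤n)))))
                  (adj-true⇒ x₂x₃)

  edge-isPath : ∀ {x z} → ρ x ≢ ρ z → IsPath G (x ∷ z ∷ [])
  edge-isPath ρx≢ρz = (adj-true ρx≢ρz ∷ [-]) , ((ρx≢ρz ∘ cong ρ) ∷ []) ∷ [] ∷ []

  detour-isPath : ∀ {x w z} → x ≢ z → ρ x ≡ ρ z → ρ w ≢ ρ x → IsPath G (x ∷ w ∷ z ∷ [])
  detour-isPath {x} {w} {z} x≢z ρx≡ρz ρw≢ρx =
    (adj-true (ρw≢ρx ∘ sym) ∷ adj-true ρw≢ρz ∷ [-]) ,
    (((ρw≢ρx ∘ sym ∘ cong ρ) ∷ x≢z ∷ []) ∷ ((ρw≢ρz ∘ cong ρ) ∷ []) ∷ [] ∷ [])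
    where
    ρw≢ρz : ρ w ≢ ρ z
    ρw≢ρz ρw≡ρz = ρw≢ρx (trans ρw≡ρz (sym ρx≡ρz))

  -- A path with ≥ 4 vertices from x₀ to z is beaten by x₀ z, or by x₀ w z for any w outside the part of x₀ and z.
  shortestPath-length≤3 : (∀ x → ∃ λ w → ρ w ≢ ρ x) → ∀ P → IsShortestPath G P → length P ≤ 3
  shortestPath-length≤3 _ []               _ = z≤n
  shortestPath-length≤3 _ (_ ∷ [])         _ = s≤s z≤n
  shortestPath-length≤3 _ (_ ∷ _ ∷ [])     _ = s≤s (s≤s z≤n)
  shortestPath-length≤3 _ (_ ∷ _ ∷ _ ∷ []) _ = ≤-refl
  shortestPath-length≤3 otherPart (x₀ ∷ x₁ ∷ x₂ ∷ x₃ ∷ xs) ((_ , (x₀∉ ∷ _)) , shortest)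
    with z , lastP , x₀≢z ← All-last x₁ (x₂ ∷ x₃ ∷ xs) x₀∉ | ρ x₀ ≟ ρ z
  ... | no ρx₀≢ρz =
    contradiction (shortest (x₀ ∷ z ∷ []) (edge-isPath ρx₀≢ρz) refl (sym lastP)) λ { (s≤s (s≤s ())) }
  ... | yes ρx₀≡ρz = let w , ρw≢ρx₀ = otherPart x₀ in
    contradiction (shortest (x₀ ∷ w ∷ z ∷ []) (detour-isPath x₀≢z ρx₀≡ρz ρw≢ρx₀) refl (sym lastP))
                  λ { (s≤s (s≤s (s≤s ()))) }

module _ .{{_ : NonZero a}} (2≤a : 2 ≤ a) (a≤n : a ≤ n) where

  private
    T : Graph n
    T = turán n a

    cᵀ : Fin n → Fin a
    cᵀ = turánColouring

    residue : Fin n → ℕ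
    residue v = toℕ v % a

    open CompleteMultipartiteBy T residue (λ _ _ → refl)

    vertexOfResidue : ∀ k → k < a → Fin n
    vertexOfResidue k k<a = fromℕ< (<-≤-trans k<a a≤n)

    residue-vertexOfResidue : ∀ k (k<a : k < a) → residue (vertexOfResidue k k<a) ≡ k
    residue-vertexOfResidue k k<a = trans (cong (_% a) (toℕ-fromℕ< (<-≤-trans k<a a≤n))) (m<n⇒m%n≡m k<a)

    residue-inject≤ : ∀ i → residue (inject≤ i a≤n) ≡ toℕ i
    residue-inject≤ i = trans (cong (_% a) (toℕ-inject≤ i a≤n)) (m<n⇒m%n≡m (toℕ<n i))

    otherPart : ∀ x → ∃ λ w → residue w ≢ residue x
    otherPart x with residue x ≟ 0
    ... | yes ρx≡0 = vertexOfResidue 1 2≤a ,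
                     λ e → 1+n≢0 (trans (sym (residue-vertexOfResidue 1 2≤a)) (trans e ρx≡0))
    ... | no  ρx≢0 = vertexOfResidue 0 (<-≤-trans z<s 2≤a) ,
                     λ e → ρx≢0 (trans (sym e) (residue-vertexOfResidue 0 (<-≤-trans z<s 2≤a)))

    path-length≤3 : ∀ π P → PathOf π T P → length P ≤ 3
    path-length≤3 gp = shortestPath-length≤3 otherPart
    path-length≤3 mp = inducedPath-length≤3

    path-linked : ∀ π P → PathOf π T P → Linked (λ x y → adj T x y ≡ true) P
    path-linked gp P ((linked , _) , _) = linked
    path-linked mp P ((linked , _) , _) = linked

    turánColouring-independent : ∀ j → Independent T (colourClass cᵀ j)
    turánColouring-independent j u v uⱼ vⱼ = cong not (≡⇒≡ᵇ≡true (trans (residueⱼ uⱼ) (sym (residueⱼ vⱼ))))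
      where
      residueⱼ : ∀ {w} → colourClass cᵀ j w ≡ true → residue w ≡ toℕ j
      residueⱼ {w} wⱼ = trans (sym (toℕ-turánColouring w)) (≡ᵇ≡true⇒≡ wⱼ)

    clique : ∀ i j → i ≢ j → adj T (inject≤ i a≤n) (inject≤ j a≤n) ≡ true
    clique i j i≢j =
      adj-true (λ e → i≢j (toℕ-injective (trans (sym (residue-inject≤ i)) (trans e (residue-inject≤ j)))))

  turán-χ : ∀ π → ChiPiI≡ π T a
  turán-χ π =
    (cᵀ , λ j → turánColouring-independent j ,
                λ P p → independent-meets-short-walk T (colourClass cᵀ j) (turánColouring-independent j) P
                          (path-linked π P p) (path-length≤3 π P p)) ,
    λ k c colouring → clique⇒≤colours T (λ i → inject≤ i a≤n) clique c (proj₁ ∘ colouring)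

mainTheorem13 : (π : PosType) (a n : ℕ) (2≤a : 2 ≤ a) → a ≤ n →
    let T = turán n a {{2≤⇒nonZero 2≤a}} in
    ChiPiI≡ π T a ×
    (∀ (G : Graph n) → ChiPiI≡ π G a → edgeCount G ≤ edgeCount T) ×
    (∀ (G : Graph n) → ChiPiI≡ π G a → edgeCount G ≡ edgeCount T → G ≅ T)
mainTheorem13 π a n 2≤a a≤n =
  turán-χ 2≤a a≤n π ,
  (λ G ((c , colouring) , _) → edgeCount-≤-turán G c (proj₁ ∘ colouring)) ,
  (λ G ((c , colouring) , _) → edgeCount-≡-turán⇒≅ G c (proj₁ ∘ colouring))
  where
  instance
    a≢0 : NonZero a
    a≢0 = 2≤⇒nonZero 2≤a
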